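{- Let $\delta$ be an ordinal and $\mathcal A\subset\mathcal P(\delta)$ be tree-like, well-founded and chain-closed. Then for each $\xi\le\delta$ the family $\mathcal A\restriction\xi=\{A\cap\xi:A\in\mathcal A\}$ is also tree-like, well-founded and chain-closed.
   Context: A family $\mathcal A$ is tree-like if for all $A,A'\in\mathcal A$ with $A\cap A'\ne\emptyset$ we have $A\subset A'$ or $A'\subset A$. It is chain-closed if for every non-empty $\mathcal B\subset\mathcal A$ linearly ordered by $\subset$, $\bigcup\mathcal B\in\mathcal A$. It is well-founded if $\langle\mathcal A,\subset\rangle$ is well-founded. -}

module Defs where

open import Level using (Level; 0ℓ) renaming (suc to lsuc)
open import Data.Product using (Σ; _×_; _,_)
open import Data.Sum using (_⊎_)
open import Data.Unit using (⊤)
open import Data.Maybe using (Maybe; just; nothing)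
open import Relation.Nullary using (¬_)
open import Relation.Binary.PropositionalEquality using (_≡_)
open import Relation.Binary.Structures using (IsStrictTotalOrder)
open import Induction.WellFounded using (WellFounded)
open import Function.Bundles using (_⇔_)

record Ordinal : Set₁ where
  field
    Carrier : Set
    _<_     : Carrier → Carrier → Set
    isSTO   : IsStrictTotalOrder _≡_ _<_
    wf      : WellFounded _<_

Sub : Set → Set₁
Sub X = X → Set

Fam : Set → Set₂
Fam X = Sub X → Set₁

module _ {X : Set} where

  _⊆_ : Sub X → Sub X → Set
  A ⊆ B = ∀ x → A x → B x

  _≐_ : Sub X → Sub X → Set
  A ≐ B = (A ⊆ B) × (B ⊆ A)

  _⊂_ : Sub X → Sub X → Set
  A ⊂ B = (A ⊆ B) × ¬ (B ⊆ A)

  _∩_ : Sub X → Sub X → Sub X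
  (A ∩ B) x = A x × B x

  TreeLike : Fam X → Set₁
  TreeLike 𝒜 = ∀ A A′ → 𝒜 A → 𝒜 A′ → Σ X (λ x → A x × A′ x) → (A ⊆ A′) ⊎ (A′ ⊆ A)

  ChainClosed : Fam X → Set₂
  ChainClosed 𝒜 =
    (ℬ : Fam X) → (∀ B → ℬ B → 𝒜 B) → Σ (Sub X) ℬ →
    (∀ B B′ → ℬ B → ℬ B′ → (B ⊆ B′) ⊎ (B′ ⊆ B)) →
    Σ (Sub X) (λ A → 𝒜 A × (∀ x → A x ⇔ Σ (Sub X) (λ B → ℬ B × B x)))

  WellFoundedFam : Fam X → Set₁
  WellFoundedFam 𝒜 = WellFounded {A = Σ (Sub X) 𝒜} (λ a b → Σ.proj₁ a ⊂ Σ.proj₁ b)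

  _↾_ : Fam X → Sub X → Fam X
  (𝒜 ↾ S) B = Σ (Sub X) (λ A → 𝒜 A × (B ≐ (A ∩ S)))

-- Ordinals ξ ≤ δ, represented by: nothing = δ itself, just β = β (for β < δ).
-- As a subset of δ: ξ = {α ∈ δ : α < ξ}.
OrdLe : Ordinal → Set
OrdLe δ = Maybe (Ordinal.Carrier δ)

asSub : (δ : Ordinal) → OrdLe δ → Sub (Ordinal.Carrier δ)
asSub δ nothing  α = ⊤
asSub δ (just β) α = Ordinal._<_ δ α β

-- Restriction to any S ⊆ X preserves the three properties. If A ∩ S and A′ ∩ S meet, so do A and A′, so the tree-like comparison of A and A′
-- transfers. For well-foundedness, a proper inclusion A″ ∩ S ⊂ A ∩ S with A″ ∩ S non-empty forces
-- A″ ⊂ A by tree-likeness, while an empty restriction is ⊂-minimal. For chain-closedness, lift a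
-- chain with a non-empty member to the chain of those A ∈ 𝒜 whose restriction is a non-empty member;
-- the restriction of its union is the union of the original chain.
module Submission where

open import Defs
open import Level using (0ℓ; suc)
open import Data.Product using (_×_; Σ; _,_; proj₁; proj₂)
open import Data.Sum using (_⊎_; inj₁; inj₂)
open import Data.Empty using (⊥-elim)
open import Relation.Nullary using (yes; no; ¬_)
open import Induction.WellFounded using (Acc; acc)
open import Function.Bundles using (_⇔_; mk⇔; Equivalence)
open import Axiom.ExcludedMiddle using (ExcludedMiddle)

module _ {X : Set} where

  Inhabited : Sub X → Set
  Inhabited B = Σ X B

  ⋃ : Fam X → X → Set₁
  ⋃ ℬ x = Σ (Sub X) (λ B → ℬ B × B x)

  IsChain : Fam X → Set₁
  IsChain ℬ = ∀ B B′ → ℬ B → ℬ B′ → (B ⊆ B′) ⊎ (B′ ⊆ B)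

  ProperSubset : (𝒜 : Fam X) → Σ (Sub X) 𝒜 → Σ (Sub X) 𝒜 → Set
  ProperSubset 𝒜 a b = proj₁ a ⊂ proj₁ b

  ∩-monoˡ-≐ : ∀ {S A A′ B B′ : Sub X} → B ≐ (A ∩ S) → B′ ≐ (A′ ∩ S) → A ⊆ A′ → B ⊆ B′
  ∩-monoˡ-≐ (B⊆A∩S , _) (_ , A′∩S⊆B′) A⊆A′ x Bx =
    let (Ax , Sx) = B⊆A∩S x Bx in A′∩S⊆B′ x (A⊆A′ x Ax , Sx)

  empty-acc : (𝒜 : Fam X) {B : Sub X} (b : 𝒜 B) → ¬ Inhabited B → Acc (ProperSubset 𝒜) (B , b)
  empty-acc _ _ B-empty = acc λ (_ , B⊈C) → ⊥-elim (B⊈C λ x Bx → ⊥-elim (B-empty (x , Bx)))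

  module _ {𝒜 : Fam X} {S : Sub X} (T : TreeLike 𝒜) where

    comparable-↾ : ∀ {A A′ B B′} → 𝒜 A → 𝒜 A′ → B ≐ (A ∩ S) → B′ ≐ (A′ ∩ S) →
                   Σ X (λ x → B x × B′ x) → (A ⊆ A′) ⊎ (A′ ⊆ A)
    comparable-↾ {A} {A′} a a′ (B⊆A∩S , _) (B′⊆A′∩S , _) (x , Bx , B′x) =
      T A A′ a a′ (x , proj₁ (B⊆A∩S x Bx) , proj₁ (B′⊆A′∩S x B′x))

    TreeLike-↾ : TreeLike (𝒜 ↾ S)
    TreeLike-↾ B B′ (A , a , e) (A′ , a′ , e′) meet with comparable-↾ a a′ e e′ meet
    ... | inj₁ A⊆A′ = inj₁ (∩-monoˡ-≐ e e′ A⊆A′)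
    ... | inj₂ A′⊆A = inj₂ (∩-monoˡ-≐ e′ e A′⊆A)

    ⊂-↾-reflect : ∀ {A A″ B B″} → 𝒜 A → 𝒜 A″ → B ≐ (A ∩ S) → B″ ≐ (A″ ∩ S) →
                  Inhabited B″ → B″ ⊂ B → A″ ⊂ A
    ⊂-↾-reflect a a″ e e″ (x , B″x) (B″⊆B , B⊈B″)
      with comparable-↾ a″ a e″ e (x , B″x , B″⊆B x B″x)
    ... | inj₁ A″⊆A = A″⊆A , λ A⊆A″ → B⊈B″ (∩-monoˡ-≐ e e″ A⊆A″)
    ... | inj₂ A⊆A″ = ⊥-elim (B⊈B″ (∩-monoˡ-≐ e e″ A⊆A″))

    module _ (em : ExcludedMiddle 0ℓ) where

      acc-↾ : ∀ {A} (a : 𝒜 A) → Acc (ProperSubset 𝒜) (A , a) → ∀ {B} (e : B ≐ (A ∩ S)) →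
              Acc (ProperSubset (𝒜 ↾ S)) (B , A , a , e)
      acc-↾ a (acc acc-below-A) e = acc below
        where
        below : ∀ {y} → ProperSubset (𝒜 ↾ S) y (_ , _ , a , e) → Acc (ProperSubset (𝒜 ↾ S)) y
        below {B″ , A″ , a″ , e″} B″⊂B with em {Inhabited B″}
        ... | no B″-empty = empty-acc (𝒜 ↾ S) (A″ , a″ , e″) B″-empty
        ... | yes B″-inhabited = acc-↾ a″ (acc-below-A (⊂-↾-reflect a a″ e e″ B″-inhabited B″⊂B)) e″

      WellFoundedFam-↾ : WellFoundedFam 𝒜 → WellFoundedFam (𝒜 ↾ S)
      WellFoundedFam-↾ W (B , A , a , e) = acc-↾ a (W (A , a)) e

    module _ (C : ChainClosed 𝒜) {ℬ : Fam X} (ℬ⊆𝒜↾S : ∀ B → ℬ B → (𝒜 ↾ S) B) (ch : IsChain ℬ) where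

      Lift : Fam X
      Lift A = 𝒜 A × Σ (Sub X) (λ B → ℬ B × (B ≐ (A ∩ S)) × Inhabited B)

      Lift-chain : IsChain Lift
      Lift-chain A A′ (a , B , b , e , x , Bx) (a′ , B′ , b′ , e′ , x′ , B′x′) with ch B B′ b b′
      ... | inj₁ B⊆B′ = comparable-↾ a a′ e e′ (x , Bx , B⊆B′ x Bx)
      ... | inj₂ B′⊆B = comparable-↾ a a′ e e′ (x′ , B′⊆B x′ B′x′ , B′x′)

      union-↾ : (B₁ : Sub X) → ℬ B₁ → Inhabited B₁ →
                Σ (Sub X) (λ U → (𝒜 ↾ S) U × (∀ x → U x ⇔ ⋃ ℬ x))
      union-↾ B₁ b₁ B₁-inhabited =
        U ∩ S , (U , u , (λ _ p → p) , (λ _ p → p)) , λ x → mk⇔ (to x) (from x)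
        where
        lifted₁ : Σ (Sub X) Lift
        lifted₁ with ℬ⊆𝒜↾S B₁ b₁
        ... | A₁ , a₁ , e₁ = A₁ , a₁ , B₁ , b₁ , e₁ , B₁-inhabited
        lifted-union : Σ (Sub X) (λ U → 𝒜 U × (∀ x → U x ⇔ ⋃ Lift x))
        lifted-union = C Lift (λ _ → proj₁) lifted₁ Lift-chain
        U = proj₁ lifted-union
        u = proj₁ (proj₂ lifted-union)
        module U≐⋃Lift x = Equivalence (proj₂ (proj₂ lifted-union) x)
        to : ∀ x → (U ∩ S) x → ⋃ ℬ x
        to x (Ux , Sx) with U≐⋃Lift.to x Ux
        ... | A , (_ , B , b , (_ , A∩S⊆B) , _) , Ax = B , b , A∩S⊆B x (Ax , Sx)
        from : ∀ x → ⋃ ℬ x → (U ∩ S) x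
        from x (B , b , Bx) with ℬ⊆𝒜↾S B b
        ... | A , a , e@(B⊆A∩S , _) =
          let (Ax , Sx) = B⊆A∩S x Bx in U≐⋃Lift.from x (A , (a , B , b , e , x , Bx) , Ax) , Sx

    ChainClosed-↾ : ExcludedMiddle (suc 0ℓ) → ChainClosed 𝒜 → ChainClosed (𝒜 ↾ S)
    ChainClosed-↾ em C ℬ ℬ⊆𝒜↾S (B₀ , b₀) ch with em {Σ (Sub X) (λ B → ℬ B × Inhabited B)}
    ... | yes (B₁ , b₁ , B₁-inhabited) = union-↾ C ℬ⊆𝒜↾S ch B₁ b₁ B₁-inhabited
    ... | no all-empty =
      B₀ , ℬ⊆𝒜↾S B₀ b₀ , λ x → mk⇔ (λ B₀x → B₀ , b₀ , B₀x)
                                   (λ (B , b , Bx) → ⊥-elim (all-empty (B , b , x , Bx)))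

lemma2p13 : ExcludedMiddle 0ℓ → ExcludedMiddle (suc 0ℓ) → ExcludedMiddle (suc (suc 0ℓ)) →
    (δ : Ordinal) (𝒜 : Fam (Ordinal.Carrier δ)) →
    TreeLike 𝒜 → WellFoundedFam 𝒜 → ChainClosed 𝒜 →
    (ξ : OrdLe δ) →
    TreeLike (𝒜 ↾ asSub δ ξ) × WellFoundedFam (𝒜 ↾ asSub δ ξ) × ChainClosed (𝒜 ↾ asSub δ ξ)
lemma2p13 em₀ em₁ _ δ 𝒜 T W C ξ =
  TreeLike-↾ T , WellFoundedFam-↾ T em₀ W , ChainClosed-↾ T em₁ C
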